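{- Let $R$ and $B$ be nonnegative $n\times n$ matrices that have the same entrywise positive left and right eigenvectors $u$ and $v$ for eigenvalue $1$ (i.e. $u^TR=u^T$, $Rv=v$, $u^TB=u^T$, $Bv=v$). Then for every nonempty proper subset $S\subset[n]$, \[ \phi_S(RB)\le\phi_S(R)+\phi_S(B). \]
   Context: For a nonnegative matrix $M$ with $u^TM=u^T$ and $Mv=v$, $\phi_S(M)=\frac{\langle\mathbf 1_S,D_uMD_v\mathbf 1_{\overline S}\rangle}{\langle\mathbf 1_S,D_uMD_v\mathbf 1\rangle}$, where $D_x=\mathrm{diag}(x)$, $\mathbf 1_S$ is the indicator vector of $S$, $\overline S$ its complement and $\mathbf 1$ the all-ones vector. -}

module Defs where

open import Level using (Level; _⊔_; suc)
open import Data.Nat using (ℕ; zero) renaming (suc to sucℕ)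
open import Data.Fin using (Fin) renaming (zero to fzero; suc to fsuc)
open import Data.Fin.Subset using (Subset; inside; outside)
open import Data.Vec using (lookup)
open import Data.Product using (_×_)
open import Relation.Nullary using (¬_; yes; no)
import Data.Fin
open import Algebra.Bundles using (CommutativeRing)
open import Algebra.Structures using (IsCommutativeRing)
open import Relation.Binary.Structures using (IsTotalOrder)

-- The inverse is total,
-- with 0⁻¹ unconstrained (Lean-style); it is only ever applied to positive
-- quantities in the statement, so its value at 0 is irrelevant.
record OrderedField (c ℓ₁ ℓ₂ : Level) : Set (suc (c ⊔ ℓ₁ ⊔ ℓ₂)) where
  infixl 7 _*_
  infixl 6 _+_
  infix  4 _≈_ _≤_
  field
    Carrier : Set c
    _≈_     : Carrier → Carrier → Set ℓ₁
    _≤_     : Carrier → Carrier → Set ℓ₂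
    _+_ _*_ : Carrier → Carrier → Carrier
    -_      : Carrier → Carrier
    0# 1#   : Carrier
    _⁻¹     : Carrier → Carrier
    isCommutativeRing : IsCommutativeRing _≈_ _+_ _*_ -_ 0# 1#
    isTotalOrder      : IsTotalOrder _≈_ _≤_
    0≉1     : ¬ (0# ≈ 1#)
    ⁻¹-inverse : ∀ x → ¬ (x ≈ 0#) → x * (x ⁻¹) ≈ 1#
    +-mono-≤   : ∀ {x y} z → x ≤ y → x + z ≤ y + z
    *-nonneg   : ∀ {x y} → 0# ≤ x → 0# ≤ y → 0# ≤ x * y

  _<_ : Carrier → Carrier → Set (ℓ₁ ⊔ ℓ₂)
  x < y = (x ≤ y) × ¬ (x ≈ y)

module _ {c ℓ₁ ℓ₂ : Level} (F : OrderedField c ℓ₁ ℓ₂) where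
  open OrderedField F

  Vector : ℕ → Set c
  Vector n = Fin n → Carrier

  Matrix : ℕ → Set c
  Matrix n = Fin n → Fin n → Carrier

  sum : ∀ {n} → (Fin n → Carrier) → Carrier
  sum {zero}   f = 0#
  sum {sucℕ n} f = f fzero + sum (λ i → f (fsuc i))

  inner : ∀ {n} → Vector n → Vector n → Carrier
  inner x y = sum (λ i → x i * y i)

  infixl 7 _·_
  _·_ : ∀ {n} → Matrix n → Matrix n → Matrix n
  (M · N) i j = sum (λ k → M i k * N k j)

  mulVec : ∀ {n} → Matrix n → Vector n → Vector n
  mulVec M x i = sum (λ j → M i j * x j)

  vecMul : ∀ {n} → Vector n → Matrix n → Vector n
  vecMul x M j = sum (λ i → x i * M i j)

  diag : ∀ {n} → Vector n → Matrix n
  diag x i j with i Data.Fin.≟ j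
  ... | yes _ = x i
  ... | no  _ = 0#

  ones : ∀ {n} → Vector n
  ones _ = 1#

  indicator : ∀ {n} → Subset n → Vector n
  indicator S i with lookup S i
  ... | inside  = 1#
  ... | outside = 0#

  coindicator : ∀ {n} → Subset n → Vector n
  coindicator S i with lookup S i
  ... | inside  = 0#
  ... | outside = 1#

  φ : ∀ {n} → Subset n → Vector n → Vector n → Matrix n → Carrier
  φ S u v M =
    inner (indicator S) (mulVec ((diag u · M) · diag v) (coindicator S))
    * (inner (indicator S) (mulVec ((diag u · M) · diag v) ones)) ⁻¹

{-# OPTIONS --safe #-}
-- Write χ, χᶜ for the indicators of S and of its complement.  If Mv = v, the denominator
-- of φ_S(M) is Σ_{i∈S} uᵢvᵢ, the same for R, B and RB (RB also fixes v), so only the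
-- numerators Σᵢⱼ χᵢ χᶜⱼ uᵢ Mᵢⱼ vⱼ have to be compared.  Expanding (RB)ᵢⱼ, substituting
-- v = Bv in the numerator of R and uᵀ = uᵀR in that of B turns all three into sums of the
-- path weights uᵢ Rᵢₖ Bₖⱼ vⱼ over triples (i, k, j), weighted by χᵢχᶜⱼ, χᵢχᶜₖ and χₖχᶜⱼ.
-- Finally χᵢχᶜⱼ ≤ χᵢχᶜₖ + χₖχᶜⱼ: a path from S to its complement through k leaves S at
-- its first or at its second step.
module Submission where

open import Defs
open import Level using (Level)
open import Data.Nat using (ℕ; zero; suc)
open import Data.Fin using (Fin; zero; suc; _≟_)
open import Data.Fin.Properties using (suc-injective)
open import Data.Fin.Subset using (Subset; Nonempty; ∁; inside; outside)
open import Data.Vec using (lookup)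
open import Data.Vec.Properties using ([]=⇒lookup)
open import Data.Product using (_,_; proj₁)
open import Data.Sum using (inj₁; inj₂)
open import Data.Empty using (⊥-elim)
open import Function using (_∘_)
open import Relation.Nullary using (¬_; yes; no)
open import Relation.Binary.PropositionalEquality as ≡ using (_≡_; _≢_)
open import Algebra.Bundles using (CommutativeRing)
open import Algebra.Structures using (IsCommutativeRing)
open import Relation.Binary.Structures using (IsTotalOrder)
open import Relation.Binary.Bundles using (Poset)
import Algebra.Properties.Ring as RingProperties
import Algebra.Properties.Semiring.Sum as SemiringSum
import Algebra.Solver.CommutativeMonoid as CommutativeMonoidSolver
import Relation.Binary.Reasoning.PartialOrder as PartialOrderReasoning

module _ {c ℓ₁ ℓ₂ : Level} (F : OrderedField c ℓ₁ ℓ₂) where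
  open OrderedField F
  open IsCommutativeRing isCommutativeRing hiding (zero)
  open IsTotalOrder isTotalOrder using (total; antisym)
    renaming (refl to ≤-refl; reflexive to ≤-reflexive; trans to ≤-trans)

  commutativeRing : CommutativeRing c ℓ₁
  commutativeRing = record { isCommutativeRing = isCommutativeRing }

  poset : Poset c ℓ₁ ℓ₂
  poset = record { isPartialOrder = IsTotalOrder.isPartialOrder isTotalOrder }

  private
    module Ring = RingProperties (CommutativeRing.ring commutativeRing)
    module Σ = SemiringSum (CommutativeRing.semiring commutativeRing)
    open CommutativeMonoidSolver (CommutativeRing.*-commutativeMonoid commutativeRing)
      using (solve) renaming (_⊕_ to infixl 7 _⊗_; _⊜_ to infix 4 _⊜*_)
  open PartialOrderReasoning poset

  +-mono-≤₂ : ∀ {x y z w} → x ≤ y → z ≤ w → x + z ≤ y + w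
  +-mono-≤₂ {x} {y} {z} {w} x≤y z≤w = begin
    x + z  ≤⟨ +-mono-≤ z x≤y ⟩
    y + z  ≈⟨ +-comm y z ⟩
    z + y  ≤⟨ +-mono-≤ y z≤w ⟩
    w + y  ≈⟨ +-comm w y ⟩
    y + w  ∎

  x≤x+y : ∀ {x y} → 0# ≤ y → x ≤ x + y
  x≤x+y {x} {y} 0≤y = begin
    x       ≈⟨ +-identityʳ x ⟨
    x + 0#  ≤⟨ +-mono-≤₂ ≤-refl 0≤y ⟩
    x + y   ∎

  x≤y+x : ∀ {x y} → 0# ≤ y → x ≤ y + x
  x≤y+x {x} {y} 0≤y = begin
    x      ≤⟨ x≤x+y 0≤y ⟩
    x + y  ≈⟨ +-comm x y ⟩
    y + x  ∎

  x≤y⇒0≤y-x : ∀ {x y} → x ≤ y → 0# ≤ y + - x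
  x≤y⇒0≤y-x {x} {y} x≤y = begin
    0#      ≈⟨ -‿inverseʳ x ⟨
    x + - x ≤⟨ +-mono-≤ (- x) x≤y ⟩
    y + - x ∎

  x≤0⇒0≤-x : ∀ {x} → x ≤ 0# → 0# ≤ - x
  x≤0⇒0≤-x {x} x≤0 = begin
    0#       ≤⟨ x≤y⇒0≤y-x x≤0 ⟩
    0# + - x ≈⟨ +-identityˡ (- x) ⟩
    - x      ∎

  *-monoʳ-≤ : ∀ {x y z} → 0# ≤ z → x ≤ y → x * z ≤ y * z
  *-monoʳ-≤ {x} {y} {z} 0≤z x≤y = begin
    x * z                  ≈⟨ +-identityˡ (x * z) ⟨
    0# + x * z             ≤⟨ +-mono-≤ (x * z) (*-nonneg (x≤y⇒0≤y-x x≤y) 0≤z) ⟩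
    (y + - x) * z + x * z  ≈⟨ distribʳ z (y + - x) x ⟨
    (y + - x + x) * z      ≈⟨ *-cong (+-assoc y (- x) x) refl ⟩
    (y + (- x + x)) * z    ≈⟨ *-cong (+-cong refl (-‿inverseˡ x)) refl ⟩
    (y + 0#) * z           ≈⟨ *-cong (+-identityʳ y) refl ⟩
    y * z                  ∎

  0≤1 : 0# ≤ 1#
  0≤1 with total 0# 1#
  ... | inj₁ 0≤1 = 0≤1
  ... | inj₂ 1≤0 = begin
    0#            ≤⟨ *-nonneg 0≤-1 0≤-1 ⟩
    - 1# * - 1#   ≈⟨ Ring.-1*x≈-x (- 1#) ⟩
    - (- 1#)      ≈⟨ Ring.-‿involutive 1# ⟩
    1#            ∎
    where
    0≤-1 : 0# ≤ - 1#
    0≤-1 = x≤0⇒0≤-x 1≤0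

  0<x⇒x≉0 : ∀ {x} → 0# < x → ¬ (x ≈ 0#)
  0<x⇒x≉0 (_ , 0≉x) x≈0 = 0≉x (sym x≈0)

  0<x⇒0≤x⁻¹ : ∀ {x} → 0# < x → 0# ≤ x ⁻¹
  0<x⇒0≤x⁻¹ {x} 0<x@(0≤x , _) with total 0# (x ⁻¹)
  ... | inj₁ 0≤x⁻¹ = 0≤x⁻¹
  ... | inj₂ x⁻¹≤0 = ⊥-elim (0≉1 (antisym 0≤1 1≤0))
    where
    1≤0 : 1# ≤ 0#
    1≤0 = begin
      1#                  ≈⟨ +-identityˡ 1# ⟨
      0# + 1#             ≤⟨ +-mono-≤ 1# (*-nonneg 0≤x (x≤0⇒0≤-x x⁻¹≤0)) ⟩
      x * - (x ⁻¹) + 1#   ≈⟨ +-cong (Ring.-‿distribʳ-* x (x ⁻¹)) refl ⟨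
      - (x * x ⁻¹) + 1#   ≈⟨ +-cong (-‿cong (⁻¹-inverse x (0<x⇒x≉0 0<x))) refl ⟩
      - 1# + 1#           ≈⟨ -‿inverseˡ 1# ⟩
      0#                  ∎

  -- The parentheses matter: _<_ has no fixity declaration, so it binds tighter than _*_.
  pos*pos⇒pos : ∀ {x y} → 0# < x → 0# < y → 0# < (x * y)
  pos*pos⇒pos {x} {y} 0<x@(0≤x , _) (0≤y , 0≉y) = *-nonneg 0≤x 0≤y , λ 0≈xy → 0≉y (begin-equality
    0#              ≈⟨ zeroʳ (x ⁻¹) ⟨
    x ⁻¹ * 0#       ≈⟨ *-cong refl 0≈xy ⟩
    x ⁻¹ * (x * y)  ≈⟨ *-assoc (x ⁻¹) x y ⟨
    x ⁻¹ * x * y    ≈⟨ *-cong (*-comm (x ⁻¹) x) refl ⟩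
    x * x ⁻¹ * y    ≈⟨ *-cong (⁻¹-inverse x (0<x⇒x≉0 0<x)) refl ⟩
    1# * y          ≈⟨ *-identityˡ y ⟩
    y               ∎)

  <-≤-trans : ∀ {x y z} → x < y → y ≤ z → x < z
  <-≤-trans (x≤y , x≉y) y≤z =
    ≤-trans x≤y y≤z , λ x≈z → x≉y (antisym x≤y (≤-trans y≤z (≤-reflexive (sym x≈z))))

  ⁻¹-cong : ∀ {x y} → ¬ (y ≈ 0#) → x ≈ y → x ⁻¹ ≈ y ⁻¹
  ⁻¹-cong {x} {y} y≉0 x≈y = begin-equality
    x ⁻¹               ≈⟨ *-identityʳ (x ⁻¹) ⟨
    x ⁻¹ * 1#          ≈⟨ *-cong refl (⁻¹-inverse y y≉0) ⟨
    x ⁻¹ * (y * y ⁻¹)  ≈⟨ *-assoc (x ⁻¹) y (y ⁻¹) ⟨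
    x ⁻¹ * y * y ⁻¹    ≈⟨ *-cong (*-cong refl x≈y) refl ⟨
    x ⁻¹ * x * y ⁻¹    ≈⟨ *-cong (*-comm (x ⁻¹) x) refl ⟩
    x * x ⁻¹ * y ⁻¹    ≈⟨ *-cong (⁻¹-inverse x (λ x≈0 → y≉0 (trans (sym x≈y) x≈0))) refl ⟩
    1# * y ⁻¹          ≈⟨ *-identityˡ (y ⁻¹) ⟩
    y ⁻¹               ∎

  pq≤ps+rq : ∀ {p q r s} → 0# ≤ p → 0# ≤ q → 0# ≤ r → 0# ≤ s →
             p ≤ 1# → q ≤ 1# → r + s ≈ 1# → p * q ≤ p * s + r * q
  pq≤ps+rq {p} {q} {r} {s} 0≤p 0≤q 0≤r 0≤s p≤1 q≤1 r+s≈1 = begin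
    p * q                        ≈⟨ *-identityʳ (p * q) ⟨
    p * q * 1#                   ≈⟨ *-cong refl r+s≈1 ⟨
    p * q * (r + s)              ≈⟨ distribˡ (p * q) r s ⟩
    p * q * r + p * q * s        ≈⟨ +-cong (solve 3 (λ P Q R → P ⊗ Q ⊗ R ⊜* P ⊗ (R ⊗ Q)) refl p q r)
                                           (solve 3 (λ P Q S → P ⊗ Q ⊗ S ⊜* Q ⊗ (P ⊗ S)) refl p q s) ⟩
    p * (r * q) + q * (p * s)    ≤⟨ +-mono-≤₂ (*-monoʳ-≤ (*-nonneg 0≤r 0≤q) p≤1)
                                              (*-monoʳ-≤ (*-nonneg 0≤p 0≤s) q≤1) ⟩
    1# * (r * q) + 1# * (p * s)  ≈⟨ +-cong (*-identityˡ (r * q)) (*-identityˡ (p * s)) ⟩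
    r * q + p * s                ≈⟨ +-comm (r * q) (p * s) ⟩
    p * s + r * q                ∎

  private
    ≈-via : ∀ {x y x′ y′} → x ≡ x′ → y ≡ y′ → x′ ≈ y′ → x ≈ y
    ≈-via ≡.refl ≡.refl x′≈y′ = x′≈y′

  sum≡∑ : ∀ {n} (f : Fin n → Carrier) → sum F f ≡ Σ.sum f
  sum≡∑ {zero}  f = ≡.refl
  sum≡∑ {suc n} f = ≡.cong (f zero +_) (sum≡∑ (λ i → f (suc i)))

  sum-cong : ∀ {n} {f g : Fin n → Carrier} → (∀ i → f i ≈ g i) → sum F f ≈ sum F g
  sum-cong {f = f} {g} f≈g = ≈-via (sum≡∑ f) (sum≡∑ g) (Σ.sum-cong-≋ f≈g)

  sum-zero : ∀ {n} {f : Fin n → Carrier} → (∀ i → f i ≈ 0#) → sum F f ≈ 0#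
  sum-zero {n} f≈0 =
    trans (sum-cong f≈0) (≈-via (sum≡∑ {n} (λ _ → 0#)) ≡.refl (Σ.sum-replicate-zero n))

  sum-distrib-+ : ∀ {n} (f g : Fin n → Carrier) → sum F (λ i → f i + g i) ≈ sum F f + sum F g
  sum-distrib-+ f g =
    ≈-via (sum≡∑ (λ i → f i + g i)) (≡.cong₂ _+_ (sum≡∑ f) (sum≡∑ g)) (Σ.∑-distrib-+ f g)

  *-distribˡ-sum : ∀ {n} x (f : Fin n → Carrier) → x * sum F f ≈ sum F (λ i → x * f i)
  *-distribˡ-sum x f = ≈-via (≡.cong (x *_) (sum≡∑ f)) (sum≡∑ (λ i → x * f i)) (Σ.*-distribˡ-sum x f)

  *-distribʳ-sum : ∀ {n} x (f : Fin n → Carrier) → sum F f * x ≈ sum F (λ i → f i * x)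
  *-distribʳ-sum x f = ≈-via (≡.cong (_* x) (sum≡∑ f)) (sum≡∑ (λ i → f i * x)) (Σ.*-distribʳ-sum x f)

  sum-comm : ∀ {m n} (f : Fin m → Fin n → Carrier) →
             sum F (λ i → sum F (f i)) ≈ sum F (λ j → sum F (λ i → f i j))
  sum-comm f = ≈-via (sum²≡∑² f) (sum²≡∑² (λ j i → f i j)) (Σ.∑-comm f)
    where
    sum²≡∑² : ∀ {m n} (g : Fin m → Fin n → Carrier) →
              sum F (λ i → sum F (g i)) ≡ Σ.sum (λ i → Σ.sum (g i))
    sum²≡∑² g = ≡.trans (sum≡∑ (λ i → sum F (g i))) (Σ.sum-cong-≗ (λ i → sum≡∑ (g i)))

  sum-vanishing-off : ∀ {n} {f : Fin n → Carrier} i → (∀ j → j ≢ i → f j ≈ 0#) → sum F f ≈ f i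
  sum-vanishing-off zero    f≈0 =
    trans (+-cong refl (sum-zero (λ j → f≈0 (suc j) λ ()))) (+-identityʳ _)
  sum-vanishing-off (suc i) f≈0 =
    trans (+-cong (f≈0 zero λ ()) (sum-vanishing-off i (λ j j≢i → f≈0 (suc j) (j≢i ∘ suc-injective))))
          (+-identityˡ _)

  sum-mono-≤ : ∀ {n} {f g : Fin n → Carrier} → (∀ i → f i ≤ g i) → sum F f ≤ sum F g
  sum-mono-≤ {zero}  _   = ≤-refl
  sum-mono-≤ {suc n} f≤g = +-mono-≤₂ (f≤g zero) (sum-mono-≤ (λ i → f≤g (suc i)))

  sum-nonneg : ∀ {n} {f : Fin n → Carrier} → (∀ i → 0# ≤ f i) → 0# ≤ sum F f
  sum-nonneg {n} {f} 0≤f = begin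
    0#                    ≈⟨ sum-zero {n} {λ _ → 0#} (λ _ → refl) ⟨
    sum F {n} (λ _ → 0#)  ≤⟨ sum-mono-≤ 0≤f ⟩
    sum F f               ∎

  term≤sum : ∀ {n} {f : Fin n → Carrier} → (∀ i → 0# ≤ f i) → ∀ i → f i ≤ sum F f
  term≤sum 0≤f zero    = x≤x+y (sum-nonneg (λ i → 0≤f (suc i)))
  term≤sum 0≤f (suc i) = ≤-trans (term≤sum (λ j → 0≤f (suc j)) i) (x≤y+x (0≤f zero))

  sum³ : ∀ {n} → (Fin n → Fin n → Fin n → Carrier) → Carrier
  sum³ f = sum F λ i → sum F λ k → sum F (f i k)

  sum³-cong : ∀ {n} {f g : Fin n → Fin n → Fin n → Carrier} →
              (∀ i k j → f i k j ≈ g i k j) → sum³ f ≈ sum³ g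
  sum³-cong f≈g = sum-cong λ i → sum-cong λ k → sum-cong (f≈g i k)

  sum³-mono-≤ : ∀ {n} {f g : Fin n → Fin n → Fin n → Carrier} →
                (∀ i k j → f i k j ≤ g i k j) → sum³ f ≤ sum³ g
  sum³-mono-≤ f≤g = sum-mono-≤ λ i → sum-mono-≤ λ k → sum-mono-≤ (f≤g i k)

  sum³-distrib-+ : ∀ {n} (f g : Fin n → Fin n → Fin n → Carrier) →
                   sum³ (λ i k j → f i k j + g i k j) ≈ sum³ f + sum³ g
  sum³-distrib-+ f g =
    trans (sum-cong λ i →
      trans (sum-cong λ k → sum-distrib-+ (f i k) (g i k))
            (sum-distrib-+ (λ k → sum F (f i k)) (λ k → sum F (g i k))))
    (sum-distrib-+ (λ i → sum F λ k → sum F (f i k)) (λ i → sum F λ k → sum F (g i k)))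

  distrib-into-sum : ∀ {n} {x s} {f g : Fin n → Carrier} →
                     s ≈ sum F f → (∀ i → x * f i ≈ g i) → x * s ≈ sum F g
  distrib-into-sum {x = x} {f = f} s≈∑f xf≈g =
    trans (*-cong refl s≈∑f) (trans (*-distribˡ-sum x f) (sum-cong xf≈g))

  diag-diagonal : ∀ {n} (x : Vector F n) i → diag F x i i ≡ x i
  diag-diagonal x i with i ≟ i
  ... | yes _   = ≡.refl
  ... | no  i≢i = ⊥-elim (i≢i ≡.refl)

  diag-offDiagonal : ∀ {n} (x : Vector F n) {i j} → i ≢ j → diag F x i j ≡ 0#
  diag-offDiagonal x {i} {j} i≢j with i ≟ j
  ... | yes i≡j = ⊥-elim (i≢j i≡j)
  ... | no  _   = ≡.refl

  diag-· : ∀ {n} (x : Vector F n) (M : Matrix F n) i j → _·_ F (diag F x) M i j ≈ x i * M i j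
  diag-· x M i j = begin-equality
    sum F (λ k → diag F x i k * M k j)  ≈⟨ sum-vanishing-off i off-i ⟩
    diag F x i i * M i j                ≡⟨ ≡.cong (_* M i j) (diag-diagonal x i) ⟩
    x i * M i j                         ∎
    where
    off-i : ∀ k → k ≢ i → diag F x i k * M k j ≈ 0#
    off-i k k≢i = trans (*-cong (reflexive (diag-offDiagonal x (k≢i ∘ ≡.sym))) refl) (zeroˡ (M k j))

  ·-diag : ∀ {n} (M : Matrix F n) (x : Vector F n) i j → _·_ F M (diag F x) i j ≈ M i j * x j
  ·-diag M x i j = begin-equality
    sum F (λ k → M i k * diag F x k j)  ≈⟨ sum-vanishing-off j off-j ⟩
    M i j * diag F x j j                ≡⟨ ≡.cong (M i j *_) (diag-diagonal x j) ⟩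
    M i j * x j                         ∎
    where
    off-j : ∀ k → k ≢ j → M i k * diag F x k j ≈ 0#
    off-j k k≢j = trans (*-cong refl (reflexive (diag-offDiagonal x k≢j))) (zeroʳ (M i k))

  diag-·-diag : ∀ {n} (x y : Vector F n) (M : Matrix F n) i j →
                _·_ F (_·_ F (diag F x) M) (diag F y) i j ≈ x i * M i j * y j
  diag-·-diag x y M i j = trans (·-diag (_·_ F (diag F x) M) y i j) (*-cong (diag-· x M i j) refl)

  mulVec-· : ∀ {n} (M N : Matrix F n) (x : Vector F n) i →
             mulVec F (_·_ F M N) x i ≈ mulVec F M (mulVec F N x) i
  mulVec-· M N x i = begin-equality
    sum F (λ j → sum F (λ k → M i k * N k j) * x j)
      ≈⟨ sum-cong (λ j → *-distribʳ-sum (x j) (λ k → M i k * N k j)) ⟩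
    sum F (λ j → sum F (λ k → M i k * N k j * x j))
      ≈⟨ sum-comm (λ j k → M i k * N k j * x j) ⟩
    sum F (λ k → sum F (λ j → M i k * N k j * x j))
      ≈⟨ sum-cong (λ k → sum-cong (λ j → *-assoc (M i k) (N k j) (x j))) ⟩
    sum F (λ k → sum F (λ j → M i k * (N k j * x j)))
      ≈⟨ sum-cong (λ k → *-distribˡ-sum (M i k) (λ j → N k j * x j)) ⟨
    sum F (λ k → M i k * sum F (λ j → N k j * x j))
      ∎

  indicator-inside : ∀ {n} (S : Subset n) {i} → lookup S i ≡ inside → indicator F S i ≡ 1#
  indicator-inside S S[i]≡inside rewrite S[i]≡inside = ≡.refl

  indicator-nonneg : ∀ {n} (S : Subset n) i → 0# ≤ indicator F S i
  indicator-nonneg S i with lookup S i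
  ... | inside  = 0≤1
  ... | outside = ≤-refl

  coindicator-nonneg : ∀ {n} (S : Subset n) i → 0# ≤ coindicator F S i
  coindicator-nonneg S i with lookup S i
  ... | inside  = ≤-refl
  ... | outside = 0≤1

  indicator≤1 : ∀ {n} (S : Subset n) i → indicator F S i ≤ 1#
  indicator≤1 S i with lookup S i
  ... | inside  = ≤-refl
  ... | outside = 0≤1

  coindicator≤1 : ∀ {n} (S : Subset n) i → coindicator F S i ≤ 1#
  coindicator≤1 S i with lookup S i
  ... | inside  = 0≤1
  ... | outside = ≤-refl

  indicator+coindicator≈1 : ∀ {n} (S : Subset n) i → indicator F S i + coindicator F S i ≈ 1#
  indicator+coindicator≈1 S i with lookup S i
  ... | inside  = +-identityʳ 1#
  ... | outside = +-identityˡ 1#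

  module _ {n : ℕ} (u v : Vector F n) (S : Subset n) where
    private
      χ χᶜ : Vector F n
      χ  = indicator F S
      χᶜ = coindicator F S

    weighted : Matrix F n → Matrix F n
    weighted M = _·_ F (_·_ F (diag F u) M) (diag F v)

    cut : Matrix F n → Carrier
    cut M = inner F χ (mulVec F (weighted M) χᶜ)

    volume : Matrix F n → Carrier
    volume M = inner F χ (mulVec F (weighted M) (ones F))

    mass : Carrier
    mass = sum F (λ i → χ i * (u i * v i))

    cut-entries : ∀ M → cut M ≈ sum F (λ i → sum F (λ j → χ i * χᶜ j * (u i * M i j * v j)))
    cut-entries M = sum-cong λ i → trans (*-distribˡ-sum (χ i) (λ j → weighted M i j * χᶜ j))
      (sum-cong λ j → trans (*-cong refl (*-cong (diag-·-diag u v M i j) refl))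
        (solve 3 (λ a w b → a ⊗ (w ⊗ b) ⊜* a ⊗ b ⊗ w) refl (χ i) (u i * M i j * v j) (χᶜ j)))

    volume≈mass : ∀ M → (∀ i → mulVec F M v i ≈ v i) → volume M ≈ mass
    volume≈mass M Mv≈v = sum-cong λ i → *-cong refl (begin-equality
      sum F (λ j → weighted M i j * 1#)  ≈⟨ sum-cong (λ j → trans (*-identityʳ _) (diag-·-diag u v M i j)) ⟩
      sum F (λ j → u i * M i j * v j)    ≈⟨ sum-cong (λ j → *-assoc (u i) (M i j) (v j)) ⟩
      sum F (λ j → u i * (M i j * v j))  ≈⟨ *-distribˡ-sum (u i) (λ j → M i j * v j) ⟨
      u i * mulVec F M v i               ≈⟨ *-cong refl (Mv≈v i) ⟩
      u i * v i                          ∎)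

    mass-pos : (∀ i → 0# < u i) → (∀ i → 0# < v i) → Nonempty S → 0# < mass
    mass-pos 0<u 0<v (i , i∈S) = <-≤-trans (pos*pos⇒pos (0<u i) (0<v i)) (begin
      u i * v i          ≈⟨ *-identityˡ (u i * v i) ⟨
      1# * (u i * v i)   ≡⟨ ≡.cong (_* (u i * v i)) (indicator-inside S ([]=⇒lookup i∈S)) ⟨
      χ i * (u i * v i)  ≤⟨ term≤sum 0≤term i ⟩
      mass               ∎)
      where
      0≤term : ∀ j → 0# ≤ χ j * (u j * v j)
      0≤term j = *-nonneg (indicator-nonneg S j) (*-nonneg (proj₁ (0<u j)) (proj₁ (0<v j)))

    φ≈cut*mass⁻¹ : ∀ {M} → 0# < mass → (∀ i → mulVec F M v i ≈ v i) →
                   φ F S u v M ≈ cut M * mass ⁻¹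
    φ≈cut*mass⁻¹ {M} 0<mass Mv≈v = *-cong refl (⁻¹-cong (0<x⇒x≉0 0<mass) (volume≈mass M Mv≈v))

    cut-triangle : ∀ i k j → χ i * χᶜ j ≤ χ i * χᶜ k + χ k * χᶜ j
    cut-triangle i k j =
      pq≤ps+rq (indicator-nonneg S i) (coindicator-nonneg S j) (indicator-nonneg S k) (coindicator-nonneg S k)
               (indicator≤1 S i) (coindicator≤1 S j) (indicator+coindicator≈1 S k)

    module _ (R B : Matrix F n) where
      private
        RB : Matrix F n
        RB = _·_ F R B

      path : Fin n → Fin n → Fin n → Carrier
      path i k j = u i * R i k * (B k j * v j)

      paths : (Fin n → Fin n → Fin n → Carrier) → Carrier
      paths w = sum³ (λ i k j → w i k j * path i k j)

      paths-mono-≤ : (∀ i j → 0# ≤ R i j) → (∀ i j → 0# ≤ B i j) →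
                     (∀ i → 0# ≤ u i) → (∀ i → 0# ≤ v i) →
                     ∀ {w w′} → (∀ i k j → w i k j ≤ w′ i k j) → paths w ≤ paths w′
      paths-mono-≤ 0≤R 0≤B 0≤u 0≤v w≤w′ = sum³-mono-≤ λ i k j →
        *-monoʳ-≤ (*-nonneg (*-nonneg (0≤u i) (0≤R i k)) (*-nonneg (0≤B k j) (0≤v j))) (w≤w′ i k j)

      paths-+ : ∀ w w′ → paths (λ i k j → w i k j + w′ i k j) ≈ paths w + paths w′
      paths-+ w w′ = trans (sum³-cong λ i k j → distribʳ (path i k j) (w i k j) (w′ i k j))
                           (sum³-distrib-+ (λ i k j → w i k j * path i k j) (λ i k j → w′ i k j * path i k j))

      cut-·≈paths : cut RB ≈ paths (λ i k j → χ i * χᶜ j)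
      cut-·≈paths = begin-equality
        cut RB
          ≈⟨ cut-entries RB ⟩
        sum F (λ i → sum F (λ j → χ i * χᶜ j * (u i * RB i j * v j)))
          ≈⟨ sum-cong (λ i → sum-cong (expand i)) ⟩
        sum F (λ i → sum F (λ j → sum F (λ k → χ i * χᶜ j * path i k j)))
          ≈⟨ sum-cong (λ i → sum-comm (λ j k → χ i * χᶜ j * path i k j)) ⟩
        paths (λ i k j → χ i * χᶜ j)
          ∎
        where
        expand : ∀ i j → χ i * χᶜ j * (u i * RB i j * v j) ≈ sum F (λ k → χ i * χᶜ j * path i k j)
        expand i j = trans
          (solve 5 (λ a b x s y → a ⊗ b ⊗ (x ⊗ s ⊗ y) ⊜* a ⊗ b ⊗ x ⊗ y ⊗ s) refl
             (χ i) (χᶜ j) (u i) (RB i j) (v j))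
          (distrib-into-sum refl λ k →
            solve 6 (λ a b x y r t → a ⊗ b ⊗ x ⊗ y ⊗ (r ⊗ t) ⊜* a ⊗ b ⊗ (x ⊗ r ⊗ (t ⊗ y))) refl
              (χ i) (χᶜ j) (u i) (v j) (R i k) (B k j))

      cut-left≈paths : (∀ i → mulVec F B v i ≈ v i) → cut R ≈ paths (λ i k j → χ i * χᶜ k)
      cut-left≈paths Bv≈v = trans (cut-entries R) (sum-cong λ i → sum-cong λ k →
        trans (sym (*-assoc (χ i * χᶜ k) (u i * R i k) (v k)))
              (distrib-into-sum (sym (Bv≈v k)) λ j → *-assoc (χ i * χᶜ k) (u i * R i k) (B k j * v j)))

      cut-right≈paths : (∀ i → vecMul F u R i ≈ u i) → cut B ≈ paths (λ i k j → χ k * χᶜ j)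
      cut-right≈paths uR≈u = begin-equality
        cut B
          ≈⟨ cut-entries B ⟩
        sum F (λ k → sum F (λ j → χ k * χᶜ j * (u k * B k j * v j)))
          ≈⟨ sum-cong (λ k → sum-cong (expand k)) ⟩
        sum F (λ k → sum F (λ j → sum F (λ i → χ k * χᶜ j * path i k j)))
          ≈⟨ sum-cong (λ k → sum-comm (λ j i → χ k * χᶜ j * path i k j)) ⟩
        sum F (λ k → sum F (λ i → sum F (λ j → χ k * χᶜ j * path i k j)))
          ≈⟨ sum-comm (λ k i → sum F (λ j → χ k * χᶜ j * path i k j)) ⟩
        paths (λ i k j → χ k * χᶜ j)
          ∎
        where
        expand : ∀ k j → χ k * χᶜ j * (u k * B k j * v j) ≈ sum F (λ i → χ k * χᶜ j * path i k j)
        expand k j = trans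
          (solve 5 (λ a b x t y → a ⊗ b ⊗ (x ⊗ t ⊗ y) ⊜* a ⊗ b ⊗ (t ⊗ y) ⊗ x) refl
             (χ k) (χᶜ j) (u k) (B k j) (v j))
          (distrib-into-sum (sym (uR≈u k)) λ i →
            solve 4 (λ a b w z → a ⊗ b ⊗ w ⊗ z ⊜* a ⊗ b ⊗ (z ⊗ w)) refl
              (χ k) (χᶜ j) (B k j * v j) (u i * R i k))

      cut-·-≤ : (∀ i j → 0# ≤ R i j) → (∀ i j → 0# ≤ B i j) →
                (∀ i → 0# ≤ u i) → (∀ i → 0# ≤ v i) →
                (∀ i → vecMul F u R i ≈ u i) → (∀ i → mulVec F B v i ≈ v i) →
                cut RB ≤ cut R + cut B
      cut-·-≤ 0≤R 0≤B 0≤u 0≤v uR≈u Bv≈v = begin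
        cut RB
          ≈⟨ cut-·≈paths ⟩
        paths (λ i k j → χ i * χᶜ j)
          ≤⟨ paths-mono-≤ 0≤R 0≤B 0≤u 0≤v cut-triangle ⟩
        paths (λ i k j → χ i * χᶜ k + χ k * χᶜ j)
          ≈⟨ paths-+ (λ i k j → χ i * χᶜ k) (λ i k j → χ k * χᶜ j) ⟩
        paths (λ i k j → χ i * χᶜ k) + paths (λ i k j → χ k * χᶜ j)
          ≈⟨ +-cong (cut-left≈paths Bv≈v) (cut-right≈paths uR≈u) ⟨
        cut R + cut B
          ∎

      φ-·-subadditive : (∀ i j → 0# ≤ R i j) → (∀ i j → 0# ≤ B i j) →
                        (∀ i → 0# < u i) → (∀ i → 0# < v i) →
                        (∀ i → vecMul F u R i ≈ u i) → (∀ i → mulVec F R v i ≈ v i) →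
                        (∀ i → mulVec F B v i ≈ v i) → Nonempty S →
                        φ F S u v RB ≤ φ F S u v R + φ F S u v B
      φ-·-subadditive 0≤R 0≤B 0<u 0<v uR≈u Rv≈v Bv≈v S≢∅ = begin
        φ F S u v RB
          ≈⟨ φ≈cut*mass⁻¹ 0<mass RBv≈v ⟩
        cut RB * mass ⁻¹
          ≤⟨ *-monoʳ-≤ (0<x⇒0≤x⁻¹ 0<mass) (cut-·-≤ 0≤R 0≤B 0≤u 0≤v uR≈u Bv≈v) ⟩
        (cut R + cut B) * mass ⁻¹
          ≈⟨ distribʳ (mass ⁻¹) (cut R) (cut B) ⟩
        cut R * mass ⁻¹ + cut B * mass ⁻¹
          ≈⟨ +-cong (φ≈cut*mass⁻¹ 0<mass Rv≈v) (φ≈cut*mass⁻¹ 0<mass Bv≈v) ⟨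
        φ F S u v R + φ F S u v B
          ∎
        where
        0<mass : 0# < mass
        0<mass = mass-pos 0<u 0<v S≢∅

        0≤u : ∀ i → 0# ≤ u i
        0≤u i = proj₁ (0<u i)

        0≤v : ∀ i → 0# ≤ v i
        0≤v i = proj₁ (0<v i)

        RBv≈v : ∀ i → mulVec F RB v i ≈ v i
        RBv≈v i = trans (mulVec-· R B v i) (trans (sum-cong λ k → *-cong refl (Bv≈v k)) (Rv≈v i))

lemma3p12 : ∀ {c ℓ₁ ℓ₂ : Level} (F : OrderedField c ℓ₁ ℓ₂) → let open OrderedField F in
    (n : ℕ) (R B : Matrix F n) (u v : Vector F n) →
    (∀ i j → 0# ≤ R i j) → (∀ i j → 0# ≤ B i j) →
    (∀ i → 0# < u i) → (∀ i → 0# < v i) →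
    (∀ j → vecMul F u R j ≈ u j) → (∀ i → mulVec F R v i ≈ v i) →
    (∀ j → vecMul F u B j ≈ u j) → (∀ i → mulVec F B v i ≈ v i) →
    (S : Subset n) → Nonempty S → Nonempty (∁ S) →
    φ F S u v (_·_ F R B) ≤ φ F S u v R + φ F S u v B
lemma3p12 F n R B u v 0≤R 0≤B 0<u 0<v uR≈u Rv≈v _ Bv≈v S S≢∅ _ =
  φ-·-subadditive F u v S R B 0≤R 0≤B 0<u 0<v uR≈u Rv≈v Bv≈v S≢∅
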